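{- Let $n\geq 3$ and let $k$ be an even integer with $3\leq k\leq 2^{n-1}$. Then $\kappa^s(Q_n;C_k)\leq\lceil\frac{2n}{k}\rceil$.
   Context: $Q_n$ is the $n$-dimensional hypercube: its vertices are the binary strings of length $n$, two vertices being adjacent iff they differ in exactly one position. $C_k$ denotes the cycle of length $k$. For connected graphs $G,H$, an $H$-substructure cut of $G$ is a set $F$ of subgraphs of $G$, each isomorphic to a connected subgraph of $H$, such that $G-V(F)$ is disconnected or trivial (a single vertex); $\kappa^s(G;H)$ is the minimum cardinality of an $H$-substructure cut of $G$. -}

module Defs where

open import Data.Nat using (ℕ; zero; suc; _+_; _*_; _∸_; _≤_)
open import Data.Nat.DivMod using (_/_)
open import Data.Fin using (Fin; toℕ)
open import Data.Vec using (Vec; lookup)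
open import Data.Bool using (Bool)
open import Data.List using (List)
open import Data.List.Relation.Unary.Any using (Any)
open import Data.Product using (Σ; ∃; _×_)
open import Data.Sum using (_⊎_)
open import Relation.Nullary using (¬_)
open import Relation.Binary.PropositionalEquality using (_≡_; _≢_)
open import Relation.Binary.Construct.Closure.ReflexiveTransitive using (Star)
open import Function.Definitions using (Injective)

-- Ceiling division ⌈ a / k ⌉ (k = 0 gives 0; unused since k ≥ 3).
ceilDiv : ℕ → ℕ → ℕ
ceilDiv a zero    = 0
ceilDiv a (suc k) = (a + k) / suc k

QV : ℕ → Set
QV n = Vec Bool n

QAdj : ∀ {n} → QV n → QV n → Set
QAdj {n} u v = Σ (Fin n) λ i → (lookup u i ≢ lookup v i)
                 × (∀ j → j ≢ i → lookup u j ≡ lookup v j)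

CAdj : (k : ℕ) → Fin k → Fin k → Set
CAdj k i j = (toℕ j ≡ suc (toℕ i)) ⊎ (toℕ i ≡ suc (toℕ j))
           ⊎ ((suc (toℕ i) ≡ k × toℕ j ≡ 0) ⊎ (suc (toℕ j) ≡ k × toℕ i ≡ 0))

-- A subgraph of Q_n isomorphic to a connected subgraph of C_k.
-- The injective map emb : Fin m → V(C_k) sends edges to edges of C_k, so it is an
-- isomorphism onto the subgraph of C_k with vertices emb(Fin m) and edges emb(E);
-- that subgraph is required to be connected (equivalently (Fin m, E) connected).
record Substructure (n k : ℕ) : Set₁ where
  field
    m         : ℕ
    nonempty  : 1 ≤ m
    vert      : Fin m → QV n
    vert-inj  : Injective _≡_ _≡_ vert
    emb       : Fin m → Fin k
    emb-inj   : Injective _≡_ _≡_ emb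
    E         : Fin m → Fin m → Set
    E-sym     : ∀ i j → E i j → E j i
    E-G       : ∀ i j → E i j → QAdj (vert i) (vert j)
    E-H       : ∀ i j → E i j → CAdj k (emb i) (emb j)
    connected : ∀ i j → Star E i j

open Substructure public

Removed : ∀ {n k} → List (Substructure n k) → QV n → Set₁
Removed F v = Any (λ S → Σ (Fin (m S)) λ i → vert S i ≡ v) F

RAdj : ∀ {n k} → List (Substructure n k) → QV n → QV n → Set₁
RAdj F u v = ¬ Removed F u × ¬ Removed F v × QAdj u v

IsCut : ∀ {n k} → List (Substructure n k) → Set₁
IsCut {n} F =
    (Σ (QV n) λ u → Σ (QV n) λ v → ¬ Removed F u × ¬ Removed F v × ¬ Star (RAdj F) u v)
  ⊎ (Σ (QV n) λ u → ¬ Removed F u × (∀ v → ¬ Removed F v → v ≡ u))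

-- Delete the n neighbours e_a of the all-zero vertex 0 of Q_n. Writing k = 2q, the zigzag path
-- e_s, e_s + e_{s+1}, e_{s+1}, …, e_{s+q-1} has 2q - 1 < k vertices, so it is a path subgraph of C_k,
-- and it removes q of those neighbours; hence ⌈n/q⌉ = ⌈2n/k⌉ zigzags isolate 0. The all-ones vertex
-- survives, since every deleted vertex has at most two 1-coordinates and n ≥ 3.
module Submission where

open import Defs
open import Data.Nat using (ℕ; _≤_; _*_; _∸_; _^_)
open import Data.Nat.Divisibility using (_∣_)
open import Data.List using (List; length)
open import Data.Product using (Σ; _×_)

open import Data.Nat using (zero; suc; _+_; _<_; _⊓_; z≤n; s≤s; ⌊_/2⌋; ⌈_/2⌉; _≟_)
open import Data.Nat.Properties
open import Data.Nat.DivMod using (_/_; _%_; m%n<n; m≡m%n+[m/n]*n; m*n/n≡m; /-monoˡ-≤)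
open import Data.Nat.Divisibility using (divides)
open import Data.Fin using (Fin; toℕ; fromℕ<; inject≤) renaming (zero to fzero; suc to fsuc; _≟_ to _≟ᶠ_)
open import Data.Fin.Properties using (toℕ-injective; toℕ-fromℕ<; toℕ-inject≤; toℕ<n)
open import Data.Vec using (lookup; tabulate; replicate)
open import Data.Vec.Properties using (lookup∘tabulate; tabulate∘lookup; tabulate-cong; lookup-replicate)
open import Data.Bool using (true; false; _∨_)
open import Data.Bool.Properties using (⇔→≡; ¬-not; ∨-comm)
open import Data.List using (applyUpTo)
open import Data.List.Properties using (length-applyUpTo)
open import Data.List.Relation.Unary.Any.Properties using (applyUpTo⁺; applyUpTo⁻)
open import Data.Product using (_,_; ∃)
open import Data.Sum using (_⊎_; inj₁; inj₂; [_,_]; reduce; map; map₂)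
open import Data.Empty using (⊥; ⊥-elim)
open import Function using (_∘_)
open import Function.Bundles using (_⇔_; mk⇔; Equivalence)
open import Relation.Nullary using (¬_; Dec; does; yes; no)
open import Relation.Binary.PropositionalEquality using (_≡_; _≢_; refl; sym; trans; cong; cong₂; subst; subst₂; module ≡-Reasoning)
open import Relation.Binary.Construct.Closure.ReflexiveTransitive using (Star; ε; _◅_; _◅◅_; gmap; reverse)

open Equivalence using (to; from)

-- The vertex e_x + e_y of Q_n (the unit vector e_x when x ≡ y).
pair : (n x y : ℕ) → QV n
pair n x y = tabulate λ j → does (toℕ j ≟ x) ∨ does (toℕ j ≟ y)

does-∨⇔⊎ : ∀ {P Q : Set} (p : Dec P) (q : Dec Q) → does p ∨ does q ≡ true ⇔ (P ⊎ Q)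
does-∨⇔⊎ (yes p) _       = mk⇔ (λ _ → inj₁ p) (λ _ → refl)
does-∨⇔⊎ (no _)  (yes q) = mk⇔ (λ _ → inj₂ q) (λ _ → refl)
does-∨⇔⊎ (no ¬p) (no ¬q) = mk⇔ (λ ()) [ ⊥-elim ∘ ¬p , ⊥-elim ∘ ¬q ]

∈-pair : ∀ {n} x y (i : Fin n) → lookup (pair n x y) i ≡ true ⇔ (toℕ i ≡ x ⊎ toℕ i ≡ y)
∈-pair x y i = subst (λ b → b ≡ true ⇔ (toℕ i ≡ x ⊎ toℕ i ≡ y))
                     (sym (lookup∘tabulate (λ j → does (toℕ j ≟ x) ∨ does (toℕ j ≟ y)) i))
                     (does-∨⇔⊎ (toℕ i ≟ x) (toℕ i ≟ y))

lookup-pair-cong : ∀ {n x y x′ y′} (i : Fin n)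
                 → (toℕ i ≡ x ⊎ toℕ i ≡ y → toℕ i ≡ x′ ⊎ toℕ i ≡ y′)
                 → (toℕ i ≡ x′ ⊎ toℕ i ≡ y′ → toℕ i ≡ x ⊎ toℕ i ≡ y)
                 → lookup (pair n x y) i ≡ lookup (pair n x′ y′) i
lookup-pair-cong {x = x} {y} {x′} {y′} i f g =
  ⇔→≡ (mk⇔ (from (∈-pair x′ y′ i) ∘ f ∘ to (∈-pair x y i))
            (from (∈-pair x y i) ∘ g ∘ to (∈-pair x′ y′ i)))

pair-comm : ∀ n x y → pair n x y ≡ pair n y x
pair-comm n x y = tabulate-cong λ j → ∨-comm (does (toℕ j ≟ x)) (does (toℕ j ≟ y))

QAdj-sym : ∀ {n} (u v : QV n) → QAdj u v → QAdj v u
QAdj-sym _ _ (i , differ , agree) = i , differ ∘ sym , λ j j≢i → sym (agree j j≢i)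

pair-adj : ∀ {n x y} → x ≢ y → y < n → QAdj (pair n x x) (pair n x y)
pair-adj {n} {x} {y} x≢y y<n = i , differ , agree
  where
  i : Fin n
  i = fromℕ< y<n
  differ : lookup (pair n x x) i ≢ lookup (pair n x y) i
  differ eq = x≢y (trans (sym (reduce (to (∈-pair x x i) y∈))) (toℕ-fromℕ< y<n))
    where y∈ = trans eq (from (∈-pair x y i) (inj₂ (toℕ-fromℕ< y<n)))
  agree : ∀ j → j ≢ i → lookup (pair n x x) j ≡ lookup (pair n x y) j
  agree j j≢i = lookup-pair-cong j (inj₁ ∘ reduce) [ inj₁ , ⊥-elim ∘ j≢i ∘ toℕ-injective ∘ j≡y⇒j≡i ]
    where j≡y⇒j≡i = λ j≡y → trans j≡y (sym (toℕ-fromℕ< y<n))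

pair-step : ∀ {n x y} → y ≡ x ⊎ y ≡ suc x → suc x < n → QAdj (pair n x y) (pair n y (suc x))
pair-step {x = x} (inj₁ refl) sx<n = pair-adj (<⇒≢ (n<1+n x)) sx<n
pair-step {n} {x} (inj₂ refl) sx<n =
  subst (λ v → QAdj v (pair n (suc x) (suc x))) (pair-comm n (suc x) x)
        (QAdj-sym (pair n (suc x) (suc x)) (pair n (suc x) x) (pair-adj (>⇒≢ (n<1+n x)) (≤-trans (n≤1+n _) sx<n)))

pair-⊆ : ∀ {n x y x′ y′ a} → y < n → x ≤ y → pair n x y ≡ pair n x′ y′
       → a ≡ x ⊎ a ≡ y → a ≡ x′ ⊎ a ≡ y′
pair-⊆ {n} {x} {y} {x′} {y′} {a} y<n x≤y eq a∈ =
  subst (λ b → b ≡ x′ ⊎ b ≡ y′) (toℕ-fromℕ< a<n)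
        (to (∈-pair x′ y′ i) (trans (cong (λ v → lookup v i) (sym eq)) (from (∈-pair x y i) i∈)))
  where
  a<n : a < n
  a<n = ≤-<-trans ([ (λ a≡x → ≤-trans (≤-reflexive a≡x) x≤y) , ≤-reflexive ] a∈) y<n
  i = fromℕ< a<n
  i∈ : toℕ i ≡ x ⊎ toℕ i ≡ y
  i∈ = subst (λ b → b ≡ x ⊎ b ≡ y) (sym (toℕ-fromℕ< a<n)) a∈

sorted-pair-unique : ∀ {x y x′ y′ : ℕ} → x ≤ y → x′ ≤ y′
                   → (∀ {a} → a ≡ x ⊎ a ≡ y → a ≡ x′ ⊎ a ≡ y′)
                   → (∀ {a} → a ≡ x′ ⊎ a ≡ y′ → a ≡ x ⊎ a ≡ y)
                   → x ≡ x′ × y ≡ y′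
sorted-pair-unique {x} {y} {x′} {y′} x≤y x′≤y′ ⊆ ⊇ = x≡x′ , y≡y′
  where
  least : ∀ {a b c} → a ≤ b → c ≡ a ⊎ c ≡ b → a ≤ c
  least _   (inj₁ c≡a) = ≤-reflexive (sym c≡a)
  least a≤b (inj₂ c≡b) = ≤-trans a≤b (≤-reflexive (sym c≡b))
  x≡x′ : x ≡ x′
  x≡x′ = ≤-antisym (least x≤y (⊇ (inj₁ refl))) (least x′≤y′ (⊆ (inj₁ refl)))
  y≡y′ : y ≡ y′
  y≡y′ with ⊆ (inj₂ refl) | ⊇ (inj₂ refl)
  ... | inj₂ y≡y′ | _         = y≡y′
  ... | inj₁ _    | inj₂ y′≡y = sym y′≡y
  ... | inj₁ y≡x′ | inj₁ y′≡x = trans y≡x′ (trans (sym x≡x′) (sym y′≡x))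

pair-injective : ∀ {n x y x′ y′} → x ≤ y → y < n → x′ ≤ y′ → y′ < n
               → pair n x y ≡ pair n x′ y′ → x ≡ x′ × y ≡ y′
pair-injective x≤y y<n x′≤y′ y′<n eq =
  sorted-pair-unique x≤y x′≤y′ (pair-⊆ y<n x≤y eq) (pair-⊆ y′<n x′≤y′ (sym eq))

true≢false : true ≢ false
true≢false ()

pair≢zeros : ∀ {n x y} → x < n → pair n x y ≢ replicate n false
pair≢zeros {n} {x} {y} x<n eq =
  true≢false (trans (sym x∈) (trans (cong (λ v → lookup v i) eq) (lookup-replicate i false)))
  where
  i = fromℕ< x<n
  x∈ = from (∈-pair x y i) (inj₁ (toℕ-fromℕ< x<n))

pair≢ones : ∀ {n x y} → 3 ≤ n → pair n x y ≢ replicate n true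
pair≢ones {suc (suc (suc _))} {x} {y} (s≤s (s≤s (s≤s _))) eq =
  three-values (∈xy fzero) (∈xy (fsuc fzero)) (∈xy (fsuc (fsuc fzero)))
  where
  ∈xy : ∀ i → toℕ i ≡ x ⊎ toℕ i ≡ y
  ∈xy i = to (∈-pair x y i) (trans (cong (λ v → lookup v i) eq) (lookup-replicate i true))
  three-values : 0 ≡ x ⊎ 0 ≡ y → 1 ≡ x ⊎ 1 ≡ y → 2 ≡ x ⊎ 2 ≡ y → ⊥
  three-values (inj₁ refl) (inj₂ refl) (inj₁ ())
  three-values (inj₁ refl) (inj₂ refl) (inj₂ ())
  three-values (inj₂ refl) (inj₁ refl) (inj₁ ())
  three-values (inj₂ refl) (inj₁ refl) (inj₂ ())

zeros-neighbour : ∀ {n} {w : QV n} → QAdj (replicate n false) w → ∃ λ (i : Fin n) → w ≡ pair n (toℕ i) (toℕ i)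
zeros-neighbour {n} {w} (i , differ , agree) =
  i , trans (sym (tabulate∘lookup w)) (trans (tabulate-cong coordinate) (tabulate∘lookup (pair n (toℕ i) (toℕ i))))
  where
  coordinate : ∀ j → lookup w j ≡ lookup (pair n (toℕ i) (toℕ i)) j
  coordinate j with j ≟ᶠ i
  ... | yes refl = trans (¬-not (differ ∘ trans (lookup-replicate i false) ∘ sym))
                         (sym (from (∈-pair (toℕ i) (toℕ i) i) (inj₁ refl)))
  ... | no j≢i   = trans (sym (agree j j≢i)) (trans (lookup-replicate j false)
                         (sym (¬-not (j≢i ∘ toℕ-injective ∘ reduce ∘ to (∈-pair (toℕ i) (toℕ i) j)))))

Consecutive : ∀ {m} → Fin m → Fin m → Set
Consecutive i j = toℕ j ≡ suc (toℕ i) ⊎ toℕ i ≡ suc (toℕ j)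

Consecutive-sym : ∀ {m} {i j : Fin m} → Consecutive i j → Consecutive j i
Consecutive-sym (inj₁ e) = inj₂ e
Consecutive-sym (inj₂ e) = inj₁ e

Consecutive-from-zero : ∀ {m} (j : Fin (suc m)) → Star Consecutive fzero j
Consecutive-from-zero fzero = ε
Consecutive-from-zero {suc m} (fsuc j) =
  inj₁ refl ◅ gmap fsuc (map (cong suc) (cong suc)) (Consecutive-from-zero j)

Consecutive-connected : ∀ {m} (i j : Fin (suc m)) → Star Consecutive i j
Consecutive-connected i j = reverse Consecutive-sym (Consecutive-from-zero i) ◅◅ Consecutive-from-zero j

pathSubstructure : ∀ {n k} m (v : ℕ → QV n) → 1 ≤ m → m ≤ k
                 → (∀ {i j} → i < m → j < m → v i ≡ v j → i ≡ j)
                 → (∀ {i} → suc i < m → QAdj (v i) (v (suc i)))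
                 → Substructure n k
pathSubstructure {n} {k} (suc m) v (s≤s z≤n) m≤k v-injective v-adjacent = record
  { m         = suc m
  ; nonempty  = s≤s z≤n
  ; vert      = v ∘ toℕ
  ; vert-inj  = λ {i} {j} → toℕ-injective ∘ v-injective (toℕ<n i) (toℕ<n j)
  ; emb       = λ i → inject≤ i m≤k
  ; emb-inj   = λ {i} {j} eq →
                  toℕ-injective (trans (sym (toℕ-inject≤ i m≤k)) (trans (cong toℕ eq) (toℕ-inject≤ j m≤k)))
  ; E         = Consecutive
  ; E-sym     = λ _ _ → Consecutive-sym
  ; E-G       = edge
  ; E-H       = cycle-edge
  ; connected = Consecutive-connected
  }
  where
  edge : ∀ i j → Consecutive i j → QAdj (v (toℕ i)) (v (toℕ j))
  edge i j (inj₁ e) = subst (QAdj (v (toℕ i)) ∘ v) (sym e) (v-adjacent (subst (_< suc m) e (toℕ<n j)))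
  edge i j (inj₂ e) = subst (λ a → QAdj (v a) (v (toℕ j))) (sym e)
                            (QAdj-sym (v (toℕ j)) (v (suc (toℕ j))) (v-adjacent (subst (_< suc m) e (toℕ<n i))))
  cycle-edge : ∀ i j → Consecutive i j → CAdj k (inject≤ i m≤k) (inject≤ j m≤k)
  cycle-edge i j e rewrite toℕ-inject≤ i m≤k | toℕ-inject≤ j m≤k = map₂ inj₁ e

⌈n/2⌉≡⌊n/2⌋⊎1+⌊n/2⌋ : ∀ t → ⌈ t /2⌉ ≡ ⌊ t /2⌋ ⊎ ⌈ t /2⌉ ≡ suc ⌊ t /2⌋
⌈n/2⌉≡⌊n/2⌋⊎1+⌊n/2⌋ zero          = inj₁ refl
⌈n/2⌉≡⌊n/2⌋⊎1+⌊n/2⌋ (suc zero)    = inj₂ refl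
⌈n/2⌉≡⌊n/2⌋⊎1+⌊n/2⌋ (suc (suc t)) = map (cong suc) (cong suc) (⌈n/2⌉≡⌊n/2⌋⊎1+⌊n/2⌋ t)

-- The path e_s, e_s + e_{s+1}, e_{s+1}, …, e_{s+r}. The offset s is added on the right so that
-- ⌈ suc t /2⌉ + s reduces to suc (⌊ t /2⌋ + s).
module Zigzag (n s r : ℕ) (r+s<n : r + s < n) where

  vertex : ℕ → QV n
  vertex t = pair n (⌊ t /2⌋ + s) (⌈ t /2⌉ + s)

  ⌊t/2⌋+s≤⌈t/2⌉+s : ∀ t → ⌊ t /2⌋ + s ≤ ⌈ t /2⌉ + s
  ⌊t/2⌋+s≤⌈t/2⌉+s t = +-monoˡ-≤ s (⌊n/2⌋≤⌈n/2⌉ t)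

  ⌈t/2⌉+s<n : ∀ {t} → t ≤ r + r → ⌈ t /2⌉ + s < n
  ⌈t/2⌉+s<n {t} t≤2r =
    ≤-<-trans (+-monoˡ-≤ s (subst (⌈ t /2⌉ ≤_) (sym (n≡⌈n+n/2⌉ r)) (⌈n/2⌉-mono t≤2r))) r+s<n

  vertex-injective : ∀ {t t′} → t < suc (r + r) → t′ < suc (r + r) → vertex t ≡ vertex t′ → t ≡ t′
  vertex-injective {t} {t′} (s≤s t≤2r) (s≤s t′≤2r) eq
    with pair-injective (⌊t/2⌋+s≤⌈t/2⌉+s t) (⌈t/2⌉+s<n t≤2r)
                        (⌊t/2⌋+s≤⌈t/2⌉+s t′) (⌈t/2⌉+s<n t′≤2r) eq
  ... | ⌊⌋≡ , ⌈⌉≡ = begin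
    t                         ≡⟨ ⌊n/2⌋+⌈n/2⌉≡n t ⟨
    ⌊ t /2⌋ + ⌈ t /2⌉         ≡⟨ cong₂ _+_ (+-cancelʳ-≡ s _ _ ⌊⌋≡) (+-cancelʳ-≡ s _ _ ⌈⌉≡) ⟩
    ⌊ t′ /2⌋ + ⌈ t′ /2⌉       ≡⟨ ⌊n/2⌋+⌈n/2⌉≡n t′ ⟩
    t′                        ∎
    where open ≡-Reasoning

  vertex-adjacent : ∀ {t} → suc t < suc (r + r) → QAdj (vertex t) (vertex (suc t))
  vertex-adjacent {t} (s≤s t+1≤2r) =
    pair-step (map (cong (_+ s)) (cong (_+ s)) (⌈n/2⌉≡⌊n/2⌋⊎1+⌊n/2⌋ t)) (⌈t/2⌉+s<n t+1≤2r)

  zigzag : ∀ {k} → suc (r + r) ≤ k → Substructure n k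
  zigzag 2r+1≤k = pathSubstructure (suc (r + r)) vertex (s≤s z≤n) 2r+1≤k vertex-injective vertex-adjacent

  zigzag-vertex : ∀ {k} (2r+1≤k : suc (r + r) ≤ k) (t : Fin (suc (r + r)))
                → ∃ λ x → ∃ λ y → x < n × vert (zigzag 2r+1≤k) t ≡ pair n x y
  zigzag-vertex _ t = _ , _ , ≤-<-trans (⌊t/2⌋+s≤⌈t/2⌉+s (toℕ t)) (⌈t/2⌉+s<n (≤-pred (toℕ<n t))) , refl

  zigzag-unit : ∀ {k} (2r+1≤k : suc (r + r) ≤ k) {b} → b ≤ r
              → ∃ λ t → vert (zigzag 2r+1≤k) t ≡ pair n (b + s) (b + s)
  zigzag-unit _ {b} b≤r = fromℕ< (s≤s (+-mono-≤ b≤r b≤r)) ,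
    cong₂ (λ x y → pair n (x + s) (y + s))
          (trans (cong ⌊_/2⌋ t≡2b) (sym (n≡⌊n+n/2⌋ b))) (trans (cong ⌈_/2⌉ t≡2b) (sym (n≡⌈n+n/2⌉ b)))
    where t≡2b = toℕ-fromℕ< (s≤s (+-mono-≤ b≤r b≤r))

<-ceilDiv : ∀ {j N} k → j * suc k < N → j < ceilDiv N (suc k)
<-ceilDiv {j} {N} k jk<N = begin-strict
  j                         <⟨ n<1+n j ⟩
  suc j                     ≡⟨ m*n/n≡m (suc j) (suc k) ⟨
  suc j * suc k / suc k     ≤⟨ /-monoˡ-≤ (suc k) [1+j]*[1+k]≤N+k ⟩
  (N + k) / suc k           ∎
  where
  open ≤-Reasoning
  [1+j]*[1+k]≤N+k : suc j * suc k ≤ N + k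
  [1+j]*[1+k]≤N+k = begin
    suc (k + j * suc k)     ≡⟨ +-suc k (j * suc k) ⟨
    k + suc (j * suc k)     ≤⟨ +-monoʳ-≤ k jk<N ⟩
    k + N                   ≡⟨ +-comm k N ⟩
    N + k                   ∎

-- Block j is a zigzag through the unit vectors e_a with a / q ≡ j; the start is capped at n - 1 only
-- so that blocks past the last one stay inside Q_n.
module Blocks (n₁ q₁ : ℕ) where

  n q : ℕ
  n = suc n₁
  q = suc q₁

  start radius : ℕ → ℕ
  start j = j * q ⊓ n₁
  radius j = q₁ ⊓ (n₁ ∸ start j)

  radius+start<n : ∀ j → radius j + start j < n
  radius+start<n j =
    s≤s (≤-trans (+-monoˡ-≤ (start j) (m⊓n≤n q₁ _)) (≤-reflexive (m∸n+n≡m (m⊓n≤n (j * q) n₁))))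

  zigzag-fits : ∀ j → suc (radius j + radius j) ≤ q * 2
  zigzag-fits j =
    s≤s (≤-trans (+-mono-≤ (m⊓n≤m q₁ _) (m⊓n≤m q₁ _)) (≤-trans (≤-reflexive 2q₁≡q₁*2) (n≤1+n _)))
    where 2q₁≡q₁*2 = trans (cong (q₁ +_) (sym (+-identityʳ q₁))) (*-comm 2 q₁)

  module Block (j : ℕ) = Zigzag n (start j) (radius j) (radius+start<n j)

  block : ℕ → Substructure n (q * 2)
  block j = Block.zigzag j (zigzag-fits j)

  blocks : List (Substructure n (q * 2))
  blocks = applyUpTo block (ceilDiv (2 * n) (q * 2))

  removed⇒pair : ∀ {w} → Removed blocks w → ∃ λ x → ∃ λ y → x < n × w ≡ pair n x y
  removed⇒pair r with applyUpTo⁻ block r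
  ... | j , _ , t , refl = Block.zigzag-vertex j (zigzag-fits j) t

  unit-removed : ∀ {a} → a < n → Removed blocks (pair n a a)
  unit-removed {a} a<n = applyUpTo⁺ block (subst (λ c → ∃ λ t → vert (block j) t ≡ pair n c c) b+s≡a unit) j<c
    where
    j = a / q
    b = a % q
    a≡b+jq : a ≡ b + j * q
    a≡b+jq = m≡m%n+[m/n]*n a q
    jq≤a : j * q ≤ a
    jq≤a = ≤-trans (m≤n+m (j * q) b) (≤-reflexive (sym a≡b+jq))
    start≡jq : start j ≡ j * q
    start≡jq = m≤n⇒m⊓n≡m (≤-trans jq≤a (≤-pred a<n))
    b+s≡a : b + start j ≡ a
    b+s≡a = trans (cong (b +_) start≡jq) (sym a≡b+jq)
    b≤radius : b ≤ radius j
    b≤radius = ⊓-glb (≤-pred (m%n<n a q)) (m+n≤o⇒m≤o∸n b (≤-trans (≤-reflexive b+s≡a) (≤-pred a<n)))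
    unit = Block.zigzag-unit j (zigzag-fits j) b≤radius
    j<c : j < ceilDiv (2 * n) (q * 2)
    j<c = <-ceilDiv (suc (q₁ * 2)) (subst₂ _<_ (*-assoc j q 2) (*-comm n 2) (*-monoˡ-< 2 (≤-<-trans jq≤a a<n)))

  zeros∉blocks : ¬ Removed blocks (replicate n false)
  zeros∉blocks r with removed⇒pair r
  ... | x , y , x<n , eq = pair≢zeros {x = x} {y} x<n (sym eq)

  ones∉blocks : 3 ≤ n → ¬ Removed blocks (replicate n true)
  ones∉blocks 3≤n r with removed⇒pair r
  ... | x , y , _ , eq = pair≢ones {x = x} {y} 3≤n (sym eq)

  zeros-neighbour∈blocks : ∀ {w} → QAdj (replicate n false) w → Removed blocks w
  zeros-neighbour∈blocks adj with zeros-neighbour adj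
  ... | i , w≡eᵢ = subst (Removed blocks) (sym w≡eᵢ) (unit-removed (toℕ<n i))

zeros≢ones : ∀ {n} → replicate (suc n) false ≢ replicate (suc n) true
zeros≢ones = true≢false ∘ sym ∘ cong (λ v → lookup v fzero)

isolated⇒cut : ∀ {n k} (F : List (Substructure n k)) {u v : QV n}
             → ¬ Removed F u → ¬ Removed F v → u ≢ v → (∀ {w} → QAdj u w → Removed F w) → IsCut F
isolated⇒cut F {u} {v} u∉F v∉F u≢v neighbours∈F = inj₁ (u , v , u∉F , v∉F , u≢v ∘ stuck refl)
  where
  stuck : ∀ {x y} → x ≡ u → Star (RAdj F) x y → u ≡ y
  stuck x≡u ε                      = sym x≡u
  stuck refl ((_ , w∉F , u~w) ◅ _) = ⊥-elim (w∉F (neighbours∈F u~w))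

lemma15 : (n k : ℕ) → 3 ≤ n → 2 ∣ k → 3 ≤ k → k ≤ 2 ^ (n ∸ 1)
    → Σ (List (Substructure n k)) λ F → IsCut F × length F ≤ ceilDiv (2 * n) k
lemma15 _ _ _ (divides zero refl) () _
lemma15 (suc n₁) _ 3≤n (divides (suc q₁) refl) _ _ =
  blocks , isolated⇒cut blocks zeros∉blocks (ones∉blocks 3≤n) zeros≢ones zeros-neighbour∈blocks
         , ≤-reflexive (length-applyUpTo block _)
  where open Blocks n₁ q₁
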